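{- Let $n,k\ge 1$ and $m\ge 2$ be integers. For a partition $P$ of $[n]=\{1,\dots,n\}$, let $D(P)$ be its linear representation, and let $R(P)$ be the partition of $[n-1]$ produced by the reduction algorithm: replace every arc $(i,j)$ of $D(P)$ by the arc $(i,j-1)$, delete the vertex $n$, and take the blocks to be the vertex sets of the connected components of the resulting digraph on $[n-1]$. Then $R$ is well defined on $\mathcal{P}(n,k,m)$ and gives a bijection $R:\mathcal{P}(n,k,m)\to\mathcal{P}(n-1,k-1,m-1)$.
   Context: A partition of $[n]$ is a set of nonempty pairwise disjoint subsets (blocks) whose union is $[n]$. $\mathcal{P}(n,k)$ denotes the set of partitions of $[n]$ with $k$ blocks. A partition is $m$-regular ($m\ge1$) if any two distinct elements $x,y$ in the same block satisfy $|x-y|\ge m$; $\mathcal{P}(n,k,m)$ is the set of $m$-regular partitions in $\mathcal{P}(n,k)$. The linear representation $D(P)$ of a partition $P$ of $[n]$ is the digraph on vertex set $[n]$ which, for each block $\{b_1<b_2<\dots<b_r\}$, contains the arcs $(b_1,b_2),(b_2,b_3),\dots,(b_{r-1},b_r)$ (a singleton block gives an isolated vertex); thus each block is a directed path through its elements in increasing order. -}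

module Defs where

open import Data.Nat using (ℕ; zero; suc; _<_; _≤_; _∸_; ∣_-_∣)
open import Data.List using (List; []; _∷_; map; upTo; concat; length)
open import Data.List.Membership.Propositional using (_∈_)
open import Data.List.Relation.Unary.All using (All)
open import Data.List.Relation.Unary.Linked using (Linked)
open import Data.List.Relation.Binary.Permutation.Propositional using (_↭_)
open import Data.Product using (Σ; _×_; ∃)
open import Relation.Binary.PropositionalEquality using (_≡_; _≢_)

interval : ℕ → List ℕ
interval n = map suc (upTo n)

-- A partition is encoded canonically as a list of blocks; each block is a
-- strictly increasing list of its elements, and blocks are listed in
-- increasing order of their minima.  This canonical form makes list equality
-- coincide with equality of partitions (as sets of sets).
Block : Set
Block = List ℕ

Partition : Set
Partition = List Block

data NonEmpty : Block → Set where
  nonEmpty : ∀ {x xs} → NonEmpty (x ∷ xs)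

data MinLt : Block → Block → Set where
  minLt : ∀ {a b xs ys} → a < b → MinLt (a ∷ xs) (b ∷ ys)

IsPartition : ℕ → Partition → Set
IsPartition n P =
  All NonEmpty P × All (Linked _<_) P × Linked MinLt P × (concat P ↭ interval n)

SameBlock : Partition → ℕ → ℕ → Set
SameBlock P x y = Σ Block λ B → B ∈ P × x ∈ B × y ∈ B

Regular : ℕ → Partition → Set
Regular m P = ∀ x y → SameBlock P x y → x ≢ y → m ≤ ∣ x - y ∣

InP : ℕ → ℕ → ℕ → Partition → Set
InP n k m P = IsPartition n P × length P ≡ k × Regular m P

data Consec : Block → ℕ → ℕ → Set where
  here  : ∀ {i j xs} → Consec (i ∷ j ∷ xs) i j
  there : ∀ {x xs i j} → Consec xs i j → Consec (x ∷ xs) i j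

Arc : Partition → ℕ → ℕ → Set
Arc P i j = Σ Block λ B → B ∈ P × Consec B i j

RArc : ℕ → Partition → ℕ → ℕ → Set
RArc n P i j' = Σ ℕ λ j → Arc P i j × j' ≡ j ∸ 1 × i ≢ n × j' ≢ n

data Conn (V : ℕ → Set) (E : ℕ → ℕ → Set) : ℕ → ℕ → Set where
  stay : ∀ {x} → V x → Conn V E x x
  fwd  : ∀ {x y z} → E x y → Conn V E y z → Conn V E x z
  bwd  : ∀ {x y z} → E y x → Conn V E y z → Conn V E x z

Reduces : ℕ → Partition → Partition → Set
Reduces n P Q =
  IsPartition (n ∸ 1) Q ×
  (∀ x y → x ∈ interval (n ∸ 1) → y ∈ interval (n ∸ 1) →
     (SameBlock Q x y → Conn (λ v → v ∈ interval (n ∸ 1)) (RArc n P) x y) ×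
     (Conn (λ v → v ∈ interval (n ∸ 1)) (RArc n P) x y → SameBlock Q x y))

{-# OPTIONS --safe #-}
-- The linear representation D(P) is a linear forest: arcs point upwards and no vertex has two
-- outgoing or two incoming arcs.  In a linear forest the arcs are determined by the connected
-- components, and every (decidable) linear forest on [N] is D(P) for exactly one canonical
-- partition P, built by adding the vertices 1, …, N in turn; its blocks correspond to the roots,
-- the vertices without incoming arc.  If P is 2-regular, lowering the target of every arc by one
-- again gives a linear forest, on [n-1], with every gap shrunk by one; R(P) is the partition with
-- exactly these arcs, and conversely raising the arcs of Q gives its unique preimage.  Since 1 is a
-- root of D(P) and v+1 is a root of D(P) iff v is one of D(R(P)), R removes exactly one block.
module Submission where

open import Defs
open import Data.Nat using (ℕ; zero; suc; _+_; _<_; _≤_; _∸_; ∣_-_∣; z≤n; s≤s; _≟_)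
open import Data.Nat.Properties
open import Data.List using (List; []; _∷_; map; concat; length; _++_; _∷ʳ_; [_])
open import Data.List.Properties using (upTo-∷ʳ; map-++; concat-++; ++-assoc; length-++; length-map; map-id-local)
open import Data.List.Membership.Propositional using (_∈_; _∉_)
open import Data.List.Membership.Propositional.Properties
  using (∈-upTo⁺; ∈-upTo⁻; ∈-map⁺; ∈-map⁻; ∈-++⁺ˡ; ∈-++⁻; ∈-concat⁺′; ∈-concat⁻′)
open import Data.List.Membership.DecPropositional _≟_ using (_∈?_)
open import Data.List.Relation.Unary.Any using (here; there)
open import Data.List.Relation.Unary.All as All using (All; []; _∷_)
import Data.List.Relation.Unary.All.Properties as All
open import Data.List.Relation.Unary.AllPairs using (_∷_)
open import Data.List.Relation.Unary.Unique.Propositional using (Unique)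
import Data.List.Relation.Unary.Unique.Propositional.Properties as Unique
open import Data.List.Relation.Unary.Linked as Linked using (Linked; []; [-]; _∷_)
import Data.List.Relation.Unary.Linked.Properties as Linked
open import Data.List.Relation.Binary.Permutation.Propositional using (_↭_; ↭-refl; ↭-sym; ↭-trans; ↭⇒↭ₛ)
open import Data.List.Relation.Binary.Permutation.Propositional.Properties using (∈-resp-↭; ++⁺ˡ; ++⁺ʳ; ∷↭∷ʳ)
open import Relation.Binary.PropositionalEquality as ≡ using (_≡_; refl; sym; cong; subst; subst₂)
open import Data.List.Relation.Binary.Permutation.Setoid.Properties (≡.setoid ℕ) using (Unique-resp-↭)
open import Data.Product using (Σ; ∃; _×_; _,_; proj₁; proj₂)
open import Data.Sum using (_⊎_; inj₁; inj₂)
open import Data.Empty using (⊥; ⊥-elim)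
open import Function using (id; flip; _∘_)
open import Function.Bundles using (_⇔_; mk⇔; module Equivalence)
open Equivalence using (to; from)
open import Relation.Binary.Construct.Closure.ReflexiveTransitive using (Star; ε; _◅_; reverse)
open import Relation.Nullary using (¬_; Dec; yes; no)
import Relation.Nullary.Decidable as Dec
open import Relation.Binary.Definitions using (Transitive; Tri; tri<; tri≈; tri>)

-- Intervals and sorted lists

∈-interval⁺ : ∀ {N x} → 1 ≤ x → x ≤ N → x ∈ interval N
∈-interval⁺ {x = suc y} (s≤s z≤n) x≤N = ∈-map⁺ suc (∈-upTo⁺ x≤N)

∈-interval⁻ : ∀ {N x} → x ∈ interval N → 1 ≤ x × x ≤ N
∈-interval⁻ x∈ with ∈-map⁻ suc x∈
... | _ , y∈ , refl = s≤s z≤n , ∈-upTo⁻ y∈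

0∉interval : ∀ {N} → 0 ∉ interval N
0∉interval 0∈ with ∈-interval⁻ 0∈
... | () , _

interval-suc : ∀ t → interval (suc t) ≡ interval t ∷ʳ suc t
interval-suc t = ≡.trans (cong (map suc) (sym (upTo-∷ʳ t))) (map-++ suc _ [ t ])

interval-unique : ∀ N → Unique (interval N)
interval-unique N = Unique.map⁺ suc-injective (Unique.upTo⁺ N)

unique-++⇒disjoint : ∀ (xs : List ℕ) {ys x} → Unique (xs ++ ys) → x ∈ xs → x ∈ ys → ⊥
unique-++⇒disjoint (_ ∷ xs) (x∉ ∷ _) (here refl) x∈ys = All.lookup (All.++⁻ʳ xs x∉) x∈ys refl
unique-++⇒disjoint (_ ∷ xs) (_ ∷ u) (there x∈xs) x∈ys = unique-++⇒disjoint xs u x∈xs x∈ys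

unique-++⁻ʳ : ∀ (xs : List ℕ) {ys} → Unique (xs ++ ys) → Unique ys
unique-++⁻ʳ [] u = u
unique-++⁻ʳ (_ ∷ xs) (_ ∷ u) = unique-++⁻ʳ xs u

linked⇒all : ∀ {A : Set} {R : A → A → Set} → Transitive R → ∀ {a xs} → Linked R (a ∷ xs) → All (R a) xs
linked⇒all trans [-] = []
linked⇒all trans (r ∷ l) = Linked.Linked⇒All trans r l

linked⇒head∉ : ∀ {a xs} → Linked _<_ (a ∷ xs) → a ∉ xs
linked⇒head∉ l a∈ = <-irrefl refl (All.lookup (linked⇒all <-trans l) a∈)

linked⇒head≤ : ∀ {a xs x} → Linked _<_ (a ∷ xs) → x ∈ a ∷ xs → a ≤ x
linked⇒head≤ l (here refl) = ≤-refl
linked⇒head≤ l (there x∈) = <⇒≤ (All.lookup (linked⇒all <-trans l) x∈)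

linked-∷ʳ : ∀ {A : Set} {R : A → A → Set} {v xs} → Linked R xs → (∀ {x} → x ∈ xs → R x v) → Linked R (xs ∷ʳ v)
linked-∷ʳ [] R-v = [-]
linked-∷ʳ [-] R-v = R-v (here refl) ∷ [-]
linked-∷ʳ (r ∷ l) R-v = r ∷ linked-∷ʳ l (λ x∈ → R-v (there x∈))

strictlySorted-≡ : ∀ {xs ys} → Linked _<_ xs → Linked _<_ ys →
                   (∀ {x} → x ∈ xs → x ∈ ys) → (∀ {x} → x ∈ ys → x ∈ xs) → xs ≡ ys
strictlySorted-≡ {[]} {[]} _ _ _ _ = refl
strictlySorted-≡ {[]} {_ ∷ _} _ _ _ ys⊆ with ys⊆ (here refl)
... | ()
strictlySorted-≡ {_ ∷ _} {[]} _ _ xs⊆ _ with xs⊆ (here refl)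
... | ()
strictlySorted-≡ {x ∷ xs} {y ∷ ys} lx ly xs⊆ ys⊆
  with ≤-antisym (linked⇒head≤ ly (xs⊆ (here refl))) (linked⇒head≤ lx (ys⊆ (here refl)))
... | refl = cong (x ∷_) (strictlySorted-≡ (Linked.tail lx) (Linked.tail ly) (tail⊆ lx xs⊆) (tail⊆ ly ys⊆))
  where
    tail⊆ : ∀ {us vs} → Linked _<_ (x ∷ us) → (∀ {z} → z ∈ x ∷ us → z ∈ x ∷ vs) → ∀ {z} → z ∈ us → z ∈ vs
    tail⊆ l ⊆ z∈ with ⊆ (there z∈)
    ... | here refl = ⊥-elim (linked⇒head∉ l z∈)
    ... | there z∈vs = z∈vs

-- Blocks as increasing paths

consec⇒∈ˡ : ∀ {B i j} → Consec B i j → i ∈ B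
consec⇒∈ˡ here = here refl
consec⇒∈ˡ (there c) = there (consec⇒∈ˡ c)

consec⇒∈ʳ : ∀ {B i j} → Consec B i j → j ∈ B
consec⇒∈ʳ here = there (here refl)
consec⇒∈ʳ (there c) = there (consec⇒∈ʳ c)

consec⇒∈tail : ∀ {a xs i j} → Consec (a ∷ xs) i j → j ∈ xs
consec⇒∈tail here = here refl
consec⇒∈tail (there c) = consec⇒∈ʳ c

consec-< : ∀ {B i j} → Linked _<_ B → Consec B i j → i < j
consec-< (i<j ∷ _) here = i<j
consec-< l (there c) = consec-< (Linked.tail l) c

consec-functional : ∀ {B i j j′} → Linked _<_ B → Consec B i j → Consec B i j′ → j ≡ j′
consec-functional l here here = refl
consec-functional l here (there c) = ⊥-elim (linked⇒head∉ l (consec⇒∈ˡ c))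
consec-functional l (there c) here = ⊥-elim (linked⇒head∉ l (consec⇒∈ˡ c))
consec-functional l (there c) (there c′) = consec-functional (Linked.tail l) c c′

consec-injective : ∀ {B i i′ j} → Linked _<_ B → Consec B i j → Consec B i′ j → i ≡ i′
consec-injective l here here = refl
consec-injective l here (there c) = ⊥-elim (linked⇒head∉ (Linked.tail l) (consec⇒∈tail c))
consec-injective l (there c) here = ⊥-elim (linked⇒head∉ (Linked.tail l) (consec⇒∈tail c))
consec-injective l (there c) (there c′) = consec-injective (Linked.tail l) c c′

consec? : ∀ B i j → Dec (Consec B i j)
consec? [] i j = no λ ()
consec? (a ∷ []) i j = no λ { (there ()) }
consec? (a ∷ b ∷ xs) i j with a ≟ i | b ≟ j | consec? (b ∷ xs) i j
... | yes refl | yes refl | _ = yes here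
... | _ | _ | yes c = yes (there c)
... | no a≢i | _ | no ¬c = no λ { here → a≢i refl ; (there c) → ¬c c }
... | yes _ | no b≢j | no ¬c = no λ { here → b≢j refl ; (there c) → ¬c c }

data Last : Block → ℕ → Set where
  [-] : ∀ {x} → Last [ x ] x
  _∷_ : ∀ {y xs} x → Last xs y → Last (x ∷ xs) y

last⊎consec : ∀ {B x} → x ∈ B → Last B x ⊎ ∃ (Consec B x)
last⊎consec {_ ∷ []} (here refl) = inj₁ [-]
last⊎consec {_ ∷ b ∷ _} (here refl) = inj₂ (b , here)
last⊎consec {a ∷ _ ∷ _} (there x∈) with last⊎consec x∈
... | inj₁ l = inj₁ (a ∷ l)
... | inj₂ (j , c) = inj₂ (j , there c)

last-unique : ∀ {B x y} → Last B x → Last B y → x ≡ y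
last-unique [-] [-] = refl
last-unique (_ ∷ l) (_ ∷ l′) = last-unique l l′
last-unique [-] (_ ∷ ())
last-unique (_ ∷ ()) [-]

consec-∷ʳ⁺ : ∀ {B v i j} → Consec B i j → Consec (B ∷ʳ v) i j
consec-∷ʳ⁺ here = here
consec-∷ʳ⁺ (there c) = there (consec-∷ʳ⁺ c)

consec-∷ʳ⁻ : ∀ B {v i j} → Consec (B ∷ʳ v) i j → Consec B i j ⊎ (Last B i × j ≡ v)
consec-∷ʳ⁻ [] (there ())
consec-∷ʳ⁻ (a ∷ []) here = inj₂ ([-] , refl)
consec-∷ʳ⁻ (a ∷ []) (there (there ()))
consec-∷ʳ⁻ (a ∷ b ∷ xs) here = inj₁ here
consec-∷ʳ⁻ (a ∷ b ∷ xs) (there c) with consec-∷ʳ⁻ (b ∷ xs) c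
... | inj₁ c′ = inj₁ (there c′)
... | inj₂ (l , j≡v) = inj₂ (a ∷ l , j≡v)

last⇒consec-∷ʳ : ∀ {B v i} → Last B i → Consec (B ∷ʳ v) i v
last⇒consec-∷ʳ [-] = here
last⇒consec-∷ʳ (_ ∷ l) = there (last⇒consec-∷ʳ l)

-- Canonical partitions

record IsCanonical (P : Partition) : Set where
  field
    blocks-nonEmpty : All NonEmpty P
    blocks-sorted   : All (Linked _<_) P
    minima-sorted   : Linked MinLt P
    blocks-disjoint : Unique (concat P)
open IsCanonical

isPartition⇒isCanonical : ∀ {N P} → IsPartition N P → IsCanonical P
isPartition⇒isCanonical {N} (ne , inc , mins , P↭[N]) = record
  { blocks-nonEmpty = ne ; blocks-sorted = inc ; minima-sorted = mins
  ; blocks-disjoint = Unique-resp-↭ (↭⇒↭ₛ (↭-sym P↭[N])) (interval-unique N) }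

isCanonical-tail : ∀ {B Ps} → IsCanonical (B ∷ Ps) → IsCanonical Ps
isCanonical-tail {B} c = record
  { blocks-nonEmpty = All.tail (blocks-nonEmpty c) ; blocks-sorted = All.tail (blocks-sorted c)
  ; minima-sorted = Linked.tail (minima-sorted c) ; blocks-disjoint = unique-++⁻ʳ B (blocks-disjoint c) }

block-unique : ∀ {P B C x} → IsCanonical P → B ∈ P → C ∈ P → x ∈ B → x ∈ C → B ≡ C
block-unique {D ∷ _} c (here refl) (here refl) _ _ = refl
block-unique {D ∷ _} c (here refl) (there C∈) x∈B x∈C = ⊥-elim (unique-++⇒disjoint D (blocks-disjoint c) x∈B (∈-concat⁺′ x∈C C∈))
block-unique {D ∷ _} c (there B∈) (here refl) x∈B x∈C = ⊥-elim (unique-++⇒disjoint D (blocks-disjoint c) x∈C (∈-concat⁺′ x∈B B∈))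
block-unique {D ∷ _} c (there B∈) (there C∈) x∈B x∈C = block-unique (isCanonical-tail c) B∈ C∈ x∈B x∈C

block⊆interval : ∀ {N P B x} → IsPartition N P → B ∈ P → x ∈ B → x ∈ interval N
block⊆interval (_ , _ , _ , P↭[N]) B∈ x∈ = ∈-resp-↭ P↭[N] (∈-concat⁺′ x∈ B∈)

arc-< : ∀ {P i j} → IsCanonical P → Arc P i j → i < j
arc-< c (B , B∈ , ij) = consec-< (All.lookup (blocks-sorted c) B∈) ij

arc-functional : ∀ {P i j j′} → IsCanonical P → Arc P i j → Arc P i j′ → j ≡ j′
arc-functional c (B , B∈ , ij) (C , C∈ , ij′) with block-unique c B∈ C∈ (consec⇒∈ˡ ij) (consec⇒∈ˡ ij′)
... | refl = consec-functional (All.lookup (blocks-sorted c) B∈) ij ij′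

arc-injective : ∀ {P i i′ j} → IsCanonical P → Arc P i j → Arc P i′ j → i ≡ i′
arc-injective c (B , B∈ , ij) (C , C∈ , i′j) with block-unique c B∈ C∈ (consec⇒∈ʳ ij) (consec⇒∈ʳ i′j)
... | refl = consec-injective (All.lookup (blocks-sorted c) B∈) ij i′j

arc⇒∈interval : ∀ {N P i j} → IsPartition N P → Arc P i j → i ∈ interval N × j ∈ interval N
arc⇒∈interval part (B , B∈ , ij) = block⊆interval part B∈ (consec⇒∈ˡ ij) , block⊆interval part B∈ (consec⇒∈ʳ ij)

arc? : ∀ P i j → Dec (Arc P i j)
arc? [] i j = no λ { (_ , () , _) }
arc? (B ∷ Ps) i j with consec? B i j | arc? Ps i j
... | yes ij | _ = yes (B , here refl , ij)
... | no _ | yes (C , C∈ , ij) = yes (C , there C∈ , ij)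
... | no ¬ij | no ¬arc = no λ { (_ , here refl , ij) → ¬ij ij ; (C , there C∈ , ij) → ¬arc (C , C∈ , ij) }

minLt-trans : Transitive MinLt
minLt-trans (minLt a<b) (minLt b<c) = minLt (<-trans a<b b<c)

minLt⇒< : ∀ {b bs C x} → MinLt (b ∷ bs) C → Linked _<_ C → x ∈ C → b < x
minLt⇒< (minLt b<c) l x∈ = <-≤-trans b<c (linked⇒head≤ l x∈)

minimum-< : ∀ {b bs Ps C x} → IsCanonical ((b ∷ bs) ∷ Ps) → C ∈ Ps → x ∈ C → b < x
minimum-< c C∈ x∈ =
  minLt⇒< (All.lookup (linked⇒all minLt-trans (minima-sorted c)) C∈) (All.lookup (All.tail (blocks-sorted c)) C∈) x∈

minimum-≤ : ∀ {b bs Ps C x} → IsCanonical ((b ∷ bs) ∷ Ps) → C ∈ (b ∷ bs) ∷ Ps → x ∈ C → b ≤ x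
minimum-≤ c (here refl) x∈ = linked⇒head≤ (All.head (blocks-sorted c)) x∈
minimum-≤ c (there C∈) x∈ = <⇒≤ (minimum-< c C∈ x∈)

head-block : ∀ {b bs Ps C} → IsCanonical ((b ∷ bs) ∷ Ps) → C ∈ (b ∷ bs) ∷ Ps → b ∈ C → C ≡ b ∷ bs
head-block c (here refl) _ = refl
head-block c (there C∈) b∈ = ⊥-elim (<-irrefl refl (minimum-< c C∈ b∈))

_Refines_ : Partition → Partition → Set
P Refines P′ = ∀ {x y} → SameBlock P x y → SameBlock P′ x y

refines⇒head≤ : ∀ {b bs Ps b′ bs′ Ps′} → IsCanonical ((b′ ∷ bs′) ∷ Ps′) →
                ((b ∷ bs) ∷ Ps) Refines ((b′ ∷ bs′) ∷ Ps′) → b′ ≤ b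
refines⇒head≤ c′ P⊑ with P⊑ (_ , here refl , here refl , here refl)
... | C , C∈ , b∈C , _ = minimum-≤ c′ C∈ b∈C

refines⇒head-block⊆ : ∀ {b bs Ps bs′ Ps′ x} → IsCanonical ((b ∷ bs′) ∷ Ps′) →
                      ((b ∷ bs) ∷ Ps) Refines ((b ∷ bs′) ∷ Ps′) → x ∈ b ∷ bs → x ∈ b ∷ bs′
refines⇒head-block⊆ c′ P⊑ x∈ with P⊑ (_ , here refl , here refl , x∈)
... | C , C∈ , b∈C , x∈C with head-block c′ C∈ b∈C
... | refl = x∈C

refines-tail : ∀ {B Ps Ps′} → IsCanonical (B ∷ Ps) → (B ∷ Ps) Refines (B ∷ Ps′) → Ps Refines Ps′
refines-tail {B} c P⊑ (C , C∈ , x∈ , y∈) with P⊑ (C , there C∈ , x∈ , y∈)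
... | D , there D∈ , x∈D , y∈D = D , D∈ , x∈D , y∈D
... | _ , here refl , x∈B , _ = ⊥-elim (unique-++⇒disjoint B (blocks-disjoint c) x∈B (∈-concat⁺′ x∈ C∈))

refines-antisym : ∀ {P P′} → IsCanonical P → IsCanonical P′ → P Refines P′ → P′ Refines P → P ≡ P′
refines-antisym {[]} {[]} _ _ _ _ = refl
refines-antisym {[]} {B′ ∷ _} _ c′ _ P′⊑ with All.head (blocks-nonEmpty c′)
... | nonEmpty with P′⊑ (B′ , here refl , here refl , here refl)
... | _ , () , _
refines-antisym {B ∷ _} {[]} c _ P⊑ _ with All.head (blocks-nonEmpty c)
... | nonEmpty with P⊑ (B , here refl , here refl , here refl)
... | _ , () , _
refines-antisym {B ∷ _} {B′ ∷ _} c c′ P⊑ P′⊑ with All.head (blocks-nonEmpty c) | All.head (blocks-nonEmpty c′)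
... | nonEmpty | nonEmpty with ≤-antisym (refines⇒head≤ c P′⊑) (refines⇒head≤ c′ P⊑)
... | refl with strictlySorted-≡ (All.head (blocks-sorted c)) (All.head (blocks-sorted c′))
                                 (refines⇒head-block⊆ c′ P⊑) (refines⇒head-block⊆ c P′⊑)
... | refl = cong (B ∷_) (refines-antisym (isCanonical-tail c) (isCanonical-tail c′) (refines-tail c P⊑) (refines-tail c′ P′⊑))

-- Connectivity and linear forests

module _ {V : ℕ → Set} {E : ℕ → ℕ → Set} where

  conn-trans : ∀ {x y z} → Conn V E x y → Conn V E y z → Conn V E x z
  conn-trans (stay _) c′ = c′
  conn-trans (fwd e c) c′ = fwd e (conn-trans c c′)
  conn-trans (bwd e c) c′ = bwd e (conn-trans c c′)

  conn-sym : ∀ {x y} → V x → Conn V E x y → Conn V E y x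
  conn-sym Vx c = reverse-onto c (stay Vx)
    where
      reverse-onto : ∀ {a b z} → Conn V E a b → Conn V E a z → Conn V E b z
      reverse-onto (stay _) c′ = c′
      reverse-onto (fwd e c) c′ = reverse-onto c (bwd e c′)
      reverse-onto (bwd e c) c′ = reverse-onto c (fwd e c′)

  head-conn : ∀ {a xs x} → (∀ {i j} → Consec (a ∷ xs) i j → E i j) → (∀ {v} → v ∈ a ∷ xs → V v) →
              x ∈ a ∷ xs → Conn V E a x
  head-conn arcs inV (here refl) = stay (inV (here refl))
  head-conn {xs = _ ∷ _} arcs inV (there x∈) =
    fwd (arcs here) (head-conn (λ ij → arcs (there ij)) (λ v∈ → inV (there v∈)) x∈)

  block-conn : ∀ {B x y} → (∀ {i j} → Consec B i j → E i j) → (∀ {v} → v ∈ B → V v) →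
               x ∈ B → y ∈ B → Conn V E x y
  block-conn {_ ∷ _} arcs inV x∈ y∈ = conn-trans (conn-sym (inV (here refl)) (head-conn arcs inV x∈)) (head-conn arcs inV y∈)

conn-map : ∀ {V E E′} → (∀ {i j} → E i j → E′ i j) → ∀ {x y} → Conn V E x y → Conn V E′ x y
conn-map f (stay Vx) = stay Vx
conn-map f (fwd e c) = fwd (f e) (conn-map f c)
conn-map f (bwd e c) = bwd (f e) (conn-map f c)

sameBlock⇒conn : ∀ {N P x y} → IsPartition N P → SameBlock P x y → Conn (_∈ interval N) (Arc P) x y
sameBlock⇒conn part (B , B∈ , x∈ , y∈) = block-conn (λ ij → B , B∈ , ij) (block⊆interval part B∈) x∈ y∈

conn⇒sameBlock : ∀ {N P x y} → IsPartition N P → Conn (_∈ interval N) (Arc P) x y → SameBlock P x y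
conn⇒sameBlock {P = P} (_ , _ , _ , P↭[N]) (stay x∈) with ∈-concat⁻′ P (∈-resp-↭ (↭-sym P↭[N]) x∈)
... | B , x∈B , B∈ = B , B∈ , x∈B , x∈B
conn⇒sameBlock part (fwd (B , B∈ , ij) c) with conn⇒sameBlock part c
... | C , C∈ , j∈C , z∈C with block-unique (isPartition⇒isCanonical part) B∈ C∈ (consec⇒∈ʳ ij) j∈C
... | refl = C , C∈ , consec⇒∈ˡ ij , z∈C
conn⇒sameBlock part (bwd (B , B∈ , ij) c) with conn⇒sameBlock part c
... | C , C∈ , i∈C , z∈C with block-unique (isPartition⇒isCanonical part) B∈ C∈ (consec⇒∈ˡ ij) i∈C
... | refl = C , C∈ , consec⇒∈ʳ ij , z∈C

arcs-refine : ∀ {N P P′} → IsPartition N P → IsPartition N P′ → (∀ {i j} → Arc P i j → Arc P′ i j) → P Refines P′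
arcs-refine part part′ P→P′ s = conn⇒sameBlock part′ (conn-map P→P′ (sameBlock⇒conn part s))

arc-extensionality : ∀ {N P P′} → IsPartition N P → IsPartition N P′ →
                     (∀ {i j} → Arc P i j → Arc P′ i j) → (∀ {i j} → Arc P′ i j → Arc P i j) → P ≡ P′
arc-extensionality part part′ P→P′ P′→P = refines-antisym (isPartition⇒isCanonical part) (isPartition⇒isCanonical part′)
  (arcs-refine part part′ P→P′) (arcs-refine part′ part P′→P)

record IsLinearForest (V : ℕ → Set) (E : ℕ → ℕ → Set) : Set where
  field
    increasing : ∀ {i j} → E i j → i < j
    functional : ∀ {i j j′} → E i j → E i j′ → j ≡ j′
    injective  : ∀ {i i′ j} → E i j → E i′ j → i ≡ i′
    endpoints  : ∀ {i j} → E i j → V i × V j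
open IsLinearForest

arc-isLinearForest : ∀ {N P} → IsPartition N P → IsLinearForest (_∈ interval N) (Arc P)
arc-isLinearForest part = record
  { increasing = arc-< c ; functional = arc-functional c ; injective = arc-injective c ; endpoints = arc⇒∈interval part }
  where c = isPartition⇒isCanonical part

module _ {V : ℕ → Set} {E : ℕ → ℕ → Set} (F : IsLinearForest V E) where

  star-≤ : ∀ {x y} → Star E x y → x ≤ y
  star-≤ ε = ≤-refl
  star-≤ (e ◅ r) = ≤-trans (<⇒≤ (increasing F e)) (star-≤ r)

  conn⇒star : ∀ {x y} → Conn V E x y → Star E x y ⊎ Star (flip E) x y
  conn⇒star (stay _) = inj₁ ε
  conn⇒star (fwd e c) with conn⇒star c
  ... | inj₁ r = inj₁ (e ◅ r)
  ... | inj₂ ε = inj₁ (e ◅ ε)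
  ... | inj₂ (e′ ◅ r) with injective F e e′
  ...   | refl = inj₂ r
  conn⇒star (bwd e c) with conn⇒star c
  ... | inj₂ r = inj₂ (e ◅ r)
  ... | inj₁ ε = inj₂ (e ◅ ε)
  ... | inj₁ (e′ ◅ r) with functional F e e′
  ...   | refl = inj₁ r

  conn⇒firstArc : ∀ {x y} → Conn V E x y → x < y → ∃ λ w → E x w × w ≤ y
  conn⇒firstArc c x<y with conn⇒star c
  ... | inj₁ ε = ⊥-elim (<-irrefl refl x<y)
  ... | inj₁ (e ◅ r) = _ , e , star-≤ r
  ... | inj₂ r = ⊥-elim (<⇒≱ x<y (star-≤ (reverse id r)))

  conn⇒endpoints : ∀ {x y} → Conn V E x y → V x × V y
  conn⇒endpoints (stay Vx) = Vx , Vx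
  conn⇒endpoints (fwd e c) = proj₁ (endpoints F e) , proj₂ (conn⇒endpoints c)
  conn⇒endpoints (bwd e c) = proj₂ (endpoints F e) , proj₂ (conn⇒endpoints c)

  arc⇒conn : ∀ {i j} → E i j → Conn V E i j
  arc⇒conn e = fwd e (stay (proj₂ (endpoints F e)))

-- The first E′-step out of i lands at some w ≤ j, and the first E-step out of i then lands at
-- or below w; functionality of E makes that step the arc to j, so w = j.
components⇒arc : ∀ {V E E′} → IsLinearForest V E → IsLinearForest V E′ →
                 (∀ {x y} → Conn V E x y → Conn V E′ x y) → (∀ {x y} → Conn V E′ x y → Conn V E x y) →
                 ∀ {i j} → E i j → E′ i j
components⇒arc {E′ = E′} F F′ E⊆E′ E′⊆E e with conn⇒firstArc F′ (E⊆E′ (arc⇒conn F e)) (increasing F e)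
... | w , e′ , w≤j with conn⇒firstArc F (E′⊆E (arc⇒conn F′ e′)) (increasing F′ e′)
... | u , e″ , u≤w with functional F e e″
... | refl = subst (E′ _) (≤-antisym w≤j u≤w) e′

-- Regularity

SpacedArcs : ℕ → Partition → Set
SpacedArcs g P = ∀ {i j} → Arc P i j → g + i ≤ j

block-spaced : ∀ {g B x y} → Linked _<_ B → (∀ {i j} → Consec B i j → g + i ≤ j) → x ∈ B → y ∈ B → x < y → g + x ≤ y
block-spaced l spaced (here refl) (here refl) x<y = ⊥-elim (<-irrefl refl x<y)
block-spaced {B = _ ∷ _ ∷ _} l spaced (here refl) (there y∈) _ = ≤-trans (spaced here) (linked⇒head≤ (Linked.tail l) y∈)
block-spaced l spaced (there x∈) (here refl) x<y = ⊥-elim (<-asym x<y (All.lookup (linked⇒all <-trans l) x∈))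
block-spaced l spaced (there x∈) (there y∈) x<y = block-spaced (Linked.tail l) (λ ij → spaced (there ij)) x∈ y∈ x<y

spacedArcs⇒regular : ∀ {g P} → IsCanonical P → SpacedArcs g P → Regular g P
spacedArcs⇒regular {g} c spaced x y (B , B∈ , x∈ , y∈) x≢y = by-cases (<-cmp x y)
  where
    ordered : ∀ {u v} → u ∈ B → v ∈ B → u < v → g ≤ ∣ u - v ∣
    ordered u∈ v∈ u<v = subst (g ≤_) (sym (m≤n⇒∣m-n∣≡n∸m (<⇒≤ u<v)))
      (m+n≤o⇒m≤o∸n g (block-spaced (All.lookup (blocks-sorted c) B∈) (λ ij → spaced (B , B∈ , ij)) u∈ v∈ u<v))
    by-cases : Tri (x < y) (x ≡ y) (y < x) → g ≤ ∣ x - y ∣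
    by-cases (tri< x<y _ _) = ordered x∈ y∈ x<y
    by-cases (tri≈ _ x≡y _) = ⊥-elim (x≢y x≡y)
    by-cases (tri> _ _ y<x) = subst (g ≤_) (∣-∣-comm y x) (ordered y∈ x∈ y<x)

regular⇒spacedArcs : ∀ {g P} → IsCanonical P → Regular g P → SpacedArcs g P
regular⇒spacedArcs {g} c reg a@(B , B∈ , ij) = m≤o∸n⇒m+n≤o g (<⇒≤ i<j)
  (subst (g ≤_) (m≤n⇒∣m-n∣≡n∸m (<⇒≤ i<j)) (reg _ _ (B , B∈ , consec⇒∈ˡ ij , consec⇒∈ʳ ij) (<⇒≢ i<j)))
  where i<j = arc-< c a

regular-≤ : ∀ {m m′ P} → m ≤ m′ → Regular m′ P → Regular m P
regular-≤ m≤m′ reg x y s x≢y = ≤-trans m≤m′ (reg x y s x≢y)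

-- Partitions realising a linear forest

count¬ : ∀ {P : ℕ → Set} → (∀ v → Dec (P v)) → ℕ → ℕ
count¬ P? zero = zero
count¬ P? (suc t) with P? (suc t)
... | yes _ = count¬ P? t
... | no _ = suc (count¬ P? t)

count¬-yes : ∀ {P : ℕ → Set} (P? : ∀ v → Dec (P v)) {t} → P (suc t) → count¬ P? (suc t) ≡ count¬ P? t
count¬-yes P? {t} p with P? (suc t)
... | yes _ = refl
... | no ¬p = ⊥-elim (¬p p)

count¬-no : ∀ {P : ℕ → Set} (P? : ∀ v → Dec (P v)) {t} → ¬ P (suc t) → count¬ P? (suc t) ≡ suc (count¬ P? t)
count¬-no P? {t} ¬p with P? (suc t)
... | yes p = ⊥-elim (¬p p)
... | no _ = refl

count¬-shift : ∀ {P Q : ℕ → Set} (P? : ∀ v → Dec (P v)) (Q? : ∀ v → Dec (Q v)) →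
               ¬ P 1 → (∀ v → P (suc (suc v)) ⇔ Q (suc v)) → ∀ t → count¬ P? (suc t) ≡ suc (count¬ Q? t)
count¬-shift P? Q? ¬P1 P⇔Q zero = count¬-no P? ¬P1
count¬-shift P? Q? ¬P1 P⇔Q (suc t) with Q? (suc t)
... | yes q = ≡.trans (count¬-yes P? (from (P⇔Q t) q)) (count¬-shift P? Q? ¬P1 P⇔Q t)
... | no ¬q = ≡.trans (count¬-no P? (¬q ∘ to (P⇔Q t))) (cong suc (count¬-shift P? Q? ¬P1 P⇔Q t))

-- The bound p < v makes HasPred decidable; for increasing E it is no restriction.
HasPred : (ℕ → ℕ → Set) → ℕ → Set
HasPred E v = ∃ λ p → p < v × E p v

hasPred? : ∀ {E : ℕ → ℕ → Set} → (∀ i j → Dec (E i j)) → ∀ v → Dec (HasPred E v)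
hasPred? E? v = anyUpTo? (λ p → E? p v) v

roots : ∀ {E : ℕ → ℕ → Set} → (∀ i j → Dec (E i j)) → ℕ → ℕ
roots E? = count¬ (hasPred? E?)

grow : ℕ → ℕ → Block → Block
grow p v B with p ∈? B
... | yes _ = B ∷ʳ v
... | no _ = B

grow-∈ : ∀ {p v B} → p ∈ B → grow p v B ≡ B ∷ʳ v
grow-∈ {p} {B = B} p∈ with p ∈? B
... | yes _ = refl
... | no p∉ = ⊥-elim (p∉ p∈)

grow-∉ : ∀ {p v B} → p ∉ B → grow p v B ≡ B
grow-∉ {p} {B = B} p∉ with p ∈? B
... | yes p∈ = ⊥-elim (p∉ p∈)
... | no _ = refl

grow-nonEmpty : ∀ {p v B} → NonEmpty B → NonEmpty (grow p v B)
grow-nonEmpty {p} {B = B} nonEmpty with p ∈? B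
... | yes _ = nonEmpty
... | no _ = nonEmpty

grow-sorted : ∀ {p v B} → Linked _<_ B → (∀ {x} → x ∈ B → x < v) → Linked _<_ (grow p v B)
grow-sorted {p} {B = B} l below with p ∈? B
... | yes _ = linked-∷ʳ l below
... | no _ = l

grow-minLt : ∀ {p v B C} → MinLt B C → MinLt (grow p v B) (grow p v C)
grow-minLt {p} {B = B} {C} (minLt b<c) with p ∈? B | p ∈? C
... | yes _ | yes _ = minLt b<c
... | yes _ | no _ = minLt b<c
... | no _ | yes _ = minLt b<c
... | no _ | no _ = minLt b<c

grow-consec : ∀ {p v B i j} → Consec B i j → Consec (grow p v B) i j
grow-consec {p} {B = B} ij with p ∈? B
... | yes _ = consec-∷ʳ⁺ ij
... | no _ = ij

EndsBlock : ℕ → Partition → Set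
EndsBlock p P = ∀ {B} → B ∈ P → p ∈ B → Last B p

module _ {p v : ℕ} where

  map-grow-∉ : ∀ {P} → p ∉ concat P → map (grow p v) P ≡ P
  map-grow-∉ p∉ = map-id-local (All.tabulate λ B∈ → grow-∉ λ p∈B → p∉ (∈-concat⁺′ p∈B B∈))

  concat-grow : ∀ {P} → Unique (concat P) → p ∈ concat P → concat (map (grow p v) P) ↭ concat P ∷ʳ v
  concat-grow {B ∷ Ps} u p∈ with p ∈? B
  ... | yes p∈B rewrite map-grow-∉ {Ps} (unique-++⇒disjoint B u p∈B) =
    subst₂ _↭_ (sym (++-assoc B [ v ] (concat Ps))) (sym (++-assoc B (concat Ps) [ v ])) (++⁺ˡ B (∷↭∷ʳ v (concat Ps)))
  ... | no p∉B with ∈-++⁻ B p∈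
  ...   | inj₁ p∈B = ⊥-elim (p∉B p∈B)
  ...   | inj₂ p∈Ps =
    subst (B ++ concat (map (grow p v) Ps) ↭_) (sym (++-assoc B (concat Ps) [ v ])) (++⁺ˡ B (concat-grow {Ps} (unique-++⁻ʳ B u) p∈Ps))

  arc-grow⁺ : ∀ {P i j} → Arc P i j → Arc (map (grow p v) P) i j
  arc-grow⁺ (B , B∈ , ij) = grow p v B , ∈-map⁺ (grow p v) B∈ , grow-consec ij

  arc-grow⁻ : ∀ {P i j} → EndsBlock p P → Arc (map (grow p v) P) i j → Arc P i j ⊎ (i ≡ p × j ≡ v)
  arc-grow⁻ {P} ends (C , C∈ , ij) with ∈-map⁻ (grow p v) C∈
  ... | B , B∈ , refl with p ∈? B
  ...   | no _ = inj₁ (B , B∈ , ij)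
  ...   | yes p∈B with consec-∷ʳ⁻ B ij
  ...     | inj₁ ij′ = inj₁ (B , B∈ , ij′)
  ...     | inj₂ (i-last , j≡v) = inj₂ (last-unique i-last (ends B∈ p∈B) , j≡v)

  arc-grow-new : ∀ {P} → p ∈ concat P → EndsBlock p P → Arc (map (grow p v) P) p v
  arc-grow-new {P} p∈ ends with ∈-concat⁻′ P p∈
  ... | B , p∈B , B∈ =
    grow p v B , ∈-map⁺ (grow p v) B∈ , subst (λ C → Consec C p v) (sym (grow-∈ p∈B)) (last⇒consec-∷ʳ (ends B∈ p∈B))

length-∷ʳ : ∀ {A : Set} (xs : List A) {x} → length (xs ∷ʳ x) ≡ suc (length xs)
length-∷ʳ xs = ≡.trans (length-++ xs) (+-comm (length xs) 1)

below-suc : ∀ {t P B x} → IsPartition t P → B ∈ P → x ∈ B → x < suc t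
below-suc part B∈ x∈ = s≤s (proj₂ (∈-interval⁻ (block⊆interval part B∈ x∈)))

minLt-singleton : ∀ {B v} → NonEmpty B → (∀ {x} → x ∈ B → x < v) → MinLt B [ v ]
minLt-singleton nonEmpty below = minLt (below (here refl))

arc-∷ʳ-singleton⁻ : ∀ {P v i j} → Arc (P ∷ʳ [ v ]) i j → Arc P i j
arc-∷ʳ-singleton⁻ {P} (B , B∈ , ij) with ∈-++⁻ P B∈
... | inj₁ B∈P = B , B∈P , ij
... | inj₂ (here refl) with ij
...   | there ()

arc-∷ʳ⁺ : ∀ {P C i j} → Arc P i j → Arc (P ∷ʳ C) i j
arc-∷ʳ⁺ (B , B∈ , ij) = B , ∈-++⁺ˡ B∈ , ij

module Realisation {N : ℕ} {E : ℕ → ℕ → Set} (F : IsLinearForest (_∈ interval N) E) (E? : ∀ i j → Dec (E i j)) where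

  record Realises (t : ℕ) (P : Partition) : Set where
    field
      partition : IsPartition t P
      sound     : ∀ {i j} → Arc P i j → E i j
      complete  : ∀ {i j} → E i j → j ≤ t → Arc P i j
      size      : length P ≡ roots E? t
  open Realises

  realises-new : ∀ {t P} → ¬ HasPred E (suc t) → Realises t P → Realises (suc t) (P ∷ʳ [ suc t ])
  realises-new {t} {P} ¬pred r@record { partition = part@(ne , sorted , mins , P↭) } = record
    { partition = All.∷ʳ⁺ ne nonEmpty , All.∷ʳ⁺ sorted [-]
                , linked-∷ʳ mins (λ B∈ → minLt-singleton (All.lookup ne B∈) (below-suc part B∈))
                , subst₂ _↭_ (concat-++ P [ [ suc t ] ]) (sym (interval-suc t)) (++⁺ʳ [ suc t ] P↭)
    ; sound = λ a → sound r (arc-∷ʳ-singleton⁻ a)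
    ; complete = complete′
    ; size = ≡.trans (length-∷ʳ P) (≡.trans (cong suc (size r)) (sym (count¬-no (hasPred? E?) ¬pred)))
    }
    where
      complete′ : ∀ {i j} → E i j → j ≤ suc t → Arc (P ∷ʳ [ suc t ]) i j
      complete′ e j≤1+t with m≤n⇒m<n∨m≡n j≤1+t
      ... | inj₁ j<1+t = arc-∷ʳ⁺ (complete r e (≤-pred j<1+t))
      ... | inj₂ refl = ⊥-elim (¬pred (_ , increasing F e , e))

  realises-grow : ∀ {t P p} → E p (suc t) → Realises t P → Realises (suc t) (map (grow p (suc t)) P)
  realises-grow {t} {P} {p} e r@record { partition = part@(ne , sorted , mins , P↭) } = record
    { partition = All.map⁺ (All.map grow-nonEmpty ne)
                , All.map⁺ (All.tabulate λ B∈ → grow-sorted (All.lookup sorted B∈) (below-suc part B∈))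
                , Linked.map⁺ (Linked.map grow-minLt mins)
                , ↭-trans (concat-grow {P = P} (blocks-disjoint (isPartition⇒isCanonical part)) p∈)
                          (subst (concat P ∷ʳ suc t ↭_) (sym (interval-suc t)) (++⁺ʳ [ suc t ] P↭))
    ; sound = sound′
    ; complete = complete′
    ; size = ≡.trans (length-map _ P) (≡.trans (size r) (sym (count¬-yes (hasPred? E?) (p , increasing F e , e))))
    }
    where
      p∈ : p ∈ concat P
      p∈ = ∈-resp-↭ (↭-sym P↭) (∈-interval⁺ (proj₁ (∈-interval⁻ (proj₁ (endpoints F e)))) (≤-pred (increasing F e)))

      ends : EndsBlock p P
      ends B∈ p∈B with last⊎consec p∈B
      ... | inj₁ p-last = p-last
      ... | inj₂ (q , pq) with functional F e (sound r (_ , B∈ , pq))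
      ...   | refl = ⊥-elim (<-irrefl refl (below-suc part B∈ (consec⇒∈ʳ pq)))

      sound′ : ∀ {i j} → Arc (map (grow p (suc t)) P) i j → E i j
      sound′ a with arc-grow⁻ ends a
      ... | inj₁ a′ = sound r a′
      ... | inj₂ (refl , refl) = e

      complete′ : ∀ {i j} → E i j → j ≤ suc t → Arc (map (grow p (suc t)) P) i j
      complete′ e′ j≤1+t with m≤n⇒m<n∨m≡n j≤1+t
      ... | inj₁ j<1+t = arc-grow⁺ (complete r e′ (≤-pred j<1+t))
      ... | inj₂ refl with injective F e′ e
      ...   | refl = arc-grow-new p∈ ends

  realisation : ∀ t → ∃ (Realises t)
  realisation zero = [] , record
    { partition = [] , [] , [] , ↭-refl
    ; sound = λ { (_ , () , _) }
    ; complete = λ { e z≤n → ⊥-elim (n≮0 (increasing F e)) }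
    ; size = refl
    }
  realisation (suc t) with realisation t | hasPred? E? (suc t)
  ... | _ , r | yes (_ , _ , e) = _ , realises-grow e r
  ... | _ , r | no ¬pred = _ , realises-new ¬pred r

linearForest⇒partition : ∀ {N E} → IsLinearForest (_∈ interval N) E → (E? : ∀ i j → Dec (E i j)) →
                         ∃ λ P → IsPartition N P × (∀ {i j} → Arc P i j ⇔ E i j) × length P ≡ roots E? N
linearForest⇒partition {N} F E? with Realisation.realisation F E? N
... | P , r = P , partition r , mk⇔ (sound r) (λ e → complete r e (proj₂ (∈-interval⁻ (proj₂ (endpoints F e))))) , size r
  where open Realisation.Realises

length≡roots : ∀ {N P} → IsPartition N P → length P ≡ roots (arc? P) N
length≡roots {P = P} part with linearForest⇒partition (arc-isLinearForest part) (arc? P)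
... | P′ , part′ , arcs , size = ≡.trans (cong length (arc-extensionality part part′ (from arcs) (to arcs))) size

-- Lowering and raising arcs

no-arc-to-0 : ∀ {N P i} → IsPartition N P → ¬ Arc P i 0
no-arc-to-0 part a = 0∉interval (proj₂ (arc⇒∈interval part a))

LoweredArc : Partition → ℕ → ℕ → Set
LoweredArc P i j = Arc P i (suc j)

data Raised (E : ℕ → ℕ → Set) : ℕ → ℕ → Set where
  ⟨_⟩ : ∀ {i j} → E i j → Raised E i (suc j)

raised⁻ : ∀ {E i j} → Raised E i (suc j) → E i j
raised⁻ ⟨ e ⟩ = e

raised? : ∀ {E} → (∀ i j → Dec (E i j)) → ∀ i j → Dec (Raised E i j)
raised? E? i zero = no λ ()
raised? E? i (suc j) = Dec.map′ ⟨_⟩ raised⁻ (E? i j)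

raised-isLinearForest : ∀ {n E} → IsLinearForest (_∈ interval n) E → IsLinearForest (_∈ interval (suc n)) (Raised E)
raised-isLinearForest {n} F = record
  { increasing = λ { ⟨ e ⟩ → m<n⇒m<1+n (increasing F e) }
  ; functional = λ { ⟨ e ⟩ ⟨ e′ ⟩ → cong suc (functional F e e′) }
  ; injective = λ { ⟨ e ⟩ ⟨ e′ ⟩ → injective F e e′ }
  ; endpoints = λ { ⟨ e ⟩ → lift (endpoints F e) }
  }
  where
    lift : ∀ {i j} → i ∈ interval n × j ∈ interval n → i ∈ interval (suc n) × suc j ∈ interval (suc n)
    lift (i∈ , j∈) with ∈-interval⁻ i∈ | ∈-interval⁻ j∈
    ... | 1≤i , i≤n | _ , j≤n = ∈-interval⁺ 1≤i (m≤n⇒m≤1+n i≤n) , ∈-interval⁺ (s≤s z≤n) (s≤s j≤n)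

lowered-isLinearForest : ∀ {n P} → IsPartition (suc n) P → Regular 2 P → IsLinearForest (_∈ interval n) (LoweredArc P)
lowered-isLinearForest {n} {P} part reg = record
  { increasing = i<j
  ; functional = λ a a′ → suc-injective (arc-functional c a a′)
  ; injective = arc-injective c
  ; endpoints = endpoints′
  }
  where
    c = isPartition⇒isCanonical part
    i<j : ∀ {i j} → LoweredArc P i j → i < j
    i<j a = ≤-pred (regular⇒spacedArcs c reg a)
    endpoints′ : ∀ {i j} → LoweredArc P i j → i ∈ interval n × j ∈ interval n
    endpoints′ a with ∈-interval⁻ (proj₁ (arc⇒∈interval part a)) | ∈-interval⁻ (proj₂ (arc⇒∈interval part a))
    ... | 1≤i , _ | _ , 1+j≤1+n =
      ∈-interval⁺ 1≤i (<⇒≤ (<-≤-trans (i<j a) (≤-pred 1+j≤1+n))) , ∈-interval⁺ (≤-trans (s≤s z≤n) (i<j a)) (≤-pred 1+j≤1+n)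

-- An arc into 0 would be lowered to the junk value 0 ∸ 1 = 0; partitions of [n] have none.
rArc⇒lowered : ∀ {n P i j} → IsPartition (suc n) P → RArc (suc n) P i j → LoweredArc P i j
rArc⇒lowered part (zero , a , _) = ⊥-elim (no-arc-to-0 part a)
rArc⇒lowered part (suc _ , a , refl , _) = a

lowered⇒rArc : ∀ {n P i j} → i ∈ interval n → j ∈ interval n → LoweredArc P i j → RArc (suc n) P i j
lowered⇒rArc i∈ j∈ a = _ , a , refl , <⇒≢ (s≤s (proj₂ (∈-interval⁻ i∈))) , <⇒≢ (s≤s (proj₂ (∈-interval⁻ j∈)))

ReducedArcs : Partition → Partition → Set
ReducedArcs P Q = ∀ {i j} → LoweredArc P i j ⇔ Arc Q i j

reducedArcs⇒reduces : ∀ {n P Q} → IsPartition (suc n) P → IsPartition n Q → ReducedArcs P Q → Reduces (suc n) P Q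
reducedArcs⇒reduces {n} {P} {Q} partP partQ PQ = partQ , λ x y _ _ →
  (λ s → conn-map Q⇒RArc (sameBlock⇒conn partQ s)) , (λ c → conn⇒sameBlock partQ (conn-map (λ r → to PQ (rArc⇒lowered partP r)) c))
  where
    Q⇒RArc : ∀ {i j} → Arc Q i j → RArc (suc n) P i j
    Q⇒RArc a = lowered⇒rArc (proj₁ (arc⇒∈interval partQ a)) (proj₂ (arc⇒∈interval partQ a)) (from PQ a)

reduces⇒reducedArcs : ∀ {n P Q} → IsPartition (suc n) P → Regular 2 P → Reduces (suc n) P Q → ReducedArcs P Q
reduces⇒reducedArcs {n} {P} {Q} partP reg (partQ , sameBlock⇔conn) =
  mk⇔ (components⇒arc F FQ lowered⇒Q Q⇒lowered) (components⇒arc FQ F Q⇒lowered lowered⇒Q)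
  where
    F = lowered-isLinearForest partP reg
    FQ = arc-isLinearForest partQ
    lowered⇒Q : ∀ {x y} → Conn (_∈ interval n) (LoweredArc P) x y → Conn (_∈ interval n) (Arc Q) x y
    lowered⇒Q c with conn⇒endpoints F c
    ... | x∈ , y∈ = sameBlock⇒conn partQ (proj₂ (sameBlock⇔conn _ _ x∈ y∈)
                      (conn-map (λ a → lowered⇒rArc (proj₁ (endpoints F a)) (proj₂ (endpoints F a)) a) c))
    Q⇒lowered : ∀ {x y} → Conn (_∈ interval n) (Arc Q) x y → Conn (_∈ interval n) (LoweredArc P) x y
    Q⇒lowered c with conn⇒endpoints FQ c
    ... | x∈ , y∈ = conn-map (rArc⇒lowered partP) (proj₁ (sameBlock⇔conn _ _ x∈ y∈) (conn⇒sameBlock partQ c))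

reduction : ∀ {n P} → IsPartition (suc n) P → Regular 2 P → ∃ λ Q → IsPartition n Q × ReducedArcs P Q
reduction {P = P} partP reg with linearForest⇒partition (lowered-isLinearForest partP reg) (λ i j → arc? P i (suc j))
... | Q , partQ , arcs , _ = Q , partQ , mk⇔ (from arcs) (to arcs)

expansion : ∀ {n Q} → IsPartition n Q → ∃ λ P → IsPartition (suc n) P × ReducedArcs P Q
expansion {Q = Q} partQ with linearForest⇒partition (raised-isLinearForest (arc-isLinearForest partQ)) (raised? (arc? Q))
... | P , partP , arcs , _ = P , partP , mk⇔ (λ a → raised⁻ (to arcs a)) (λ a → from arcs ⟨ a ⟩)

reducedArcs-injectiveˡ : ∀ {n P P′ Q} → IsPartition (suc n) P → IsPartition (suc n) P′ →
                         ReducedArcs P Q → ReducedArcs P′ Q → P ≡ P′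
reducedArcs-injectiveˡ {n} {Q = Q} partP partP′ PQ P′Q =
  arc-extensionality partP partP′ (transfer partP PQ P′Q) (transfer partP′ P′Q PQ)
  where
    transfer : ∀ {P₁ P₂} → IsPartition (suc n) P₁ → ReducedArcs P₁ Q → ReducedArcs P₂ Q → ∀ {i j} → Arc P₁ i j → Arc P₂ i j
    transfer part₁ _ _ {j = zero} a = ⊥-elim (no-arc-to-0 part₁ a)
    transfer _ P₁Q P₂Q {j = suc _} a = from P₂Q (to P₁Q a)

reducedArcs-injectiveʳ : ∀ {n P Q Q′} → IsPartition n Q → IsPartition n Q′ → ReducedArcs P Q → ReducedArcs P Q′ → Q ≡ Q′
reducedArcs-injectiveʳ partQ partQ′ PQ PQ′ = arc-extensionality partQ partQ′ (λ a → to PQ′ (from PQ a)) (λ a → to PQ (from PQ′ a))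

reducedArcs-length : ∀ {n P Q} → IsPartition (suc n) P → IsPartition n Q → ReducedArcs P Q → length P ≡ suc (length Q)
reducedArcs-length {n} {P} {Q} partP partQ PQ = begin
  length P                   ≡⟨ length≡roots partP ⟩
  roots (arc? P) (suc n)     ≡⟨ count¬-shift (hasPred? (arc? P)) (hasPred? (arc? Q)) no-pred-1 pred-shift n ⟩
  suc (roots (arc? Q) n)     ≡⟨ cong suc (sym (length≡roots partQ)) ⟩
  suc (length Q)             ∎
  where
    open ≡.≡-Reasoning
    no-pred-1 : ¬ HasPred (Arc P) 1
    no-pred-1 (_ , s≤s z≤n , a) = 0∉interval (proj₁ (arc⇒∈interval partP a))
    pred-shift : ∀ v → HasPred (Arc P) (suc (suc v)) ⇔ HasPred (Arc Q) (suc v)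
    pred-shift v = mk⇔ (λ { (p , _ , a) → p , arc-< (isPartition⇒isCanonical partQ) (to PQ a) , to PQ a })
                       (λ { (p , p<1+v , a) → p , m<n⇒m<1+n p<1+v , from PQ a })

reducedArcs-regular : ∀ {n m P Q} → IsPartition (suc n) P → IsPartition n Q → ReducedArcs P Q → Regular (suc m) P ⇔ Regular m Q
reducedArcs-regular {m = m} {P} {Q} partP partQ PQ = mk⇔
  (λ reg → spacedArcs⇒regular cQ λ a → ≤-pred (regular⇒spacedArcs cP reg (from PQ a)))
  (λ reg → spacedArcs⇒regular cP (spaced reg))
  where
    cP = isPartition⇒isCanonical partP
    cQ = isPartition⇒isCanonical partQ
    spaced : Regular m Q → SpacedArcs (suc m) P
    spaced _ {j = zero} a = ⊥-elim (no-arc-to-0 partP a)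
    spaced reg {j = suc _} a = s≤s (regular⇒spacedArcs cQ reg (to PQ a))

theorem2p2 : ∀ (n k m : ℕ) → 1 ≤ n → 1 ≤ k → 2 ≤ m →
    -- R is well defined on 𝒫(n,k,m), with values in 𝒫(n-1,k-1,m-1)
    (∀ P → InP n k m P →
      Σ Partition λ Q → Reduces n P Q × InP (n ∸ 1) (k ∸ 1) (m ∸ 1) Q) ×
    (∀ P Q Q′ → InP n k m P → Reduces n P Q → Reduces n P Q′ → Q ≡ Q′) ×
    -- injective
    (∀ P P′ Q → InP n k m P → InP n k m P′ → Reduces n P Q → Reduces n P′ Q → P ≡ P′) ×
    -- surjective
    (∀ Q → InP (n ∸ 1) (k ∸ 1) (m ∸ 1) Q →
      Σ Partition λ P → InP n k m P × Reduces n P Q)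
theorem2p2 (suc n) (suc k) (suc (suc m)) (s≤s z≤n) (s≤s z≤n) 2≤m@(s≤s (s≤s z≤n)) =
  well-defined , single-valued , one-to-one , onto
  where
    2-regular : ∀ {P} → Regular (suc (suc m)) P → Regular 2 P
    2-regular = regular-≤ 2≤m

    well-defined : ∀ P → InP (suc n) (suc k) (suc (suc m)) P → Σ Partition λ Q → Reduces (suc n) P Q × InP n k (suc m) Q
    well-defined P (partP , lenP , regP) with reduction partP (2-regular regP)
    ... | Q , partQ , PQ = Q , reducedArcs⇒reduces partP partQ PQ , partQ
                         , suc-injective (≡.trans (sym (reducedArcs-length partP partQ PQ)) lenP)
                         , to (reducedArcs-regular partP partQ PQ) regP

    single-valued : ∀ P Q Q′ → InP (suc n) (suc k) (suc (suc m)) P → Reduces (suc n) P Q → Reduces (suc n) P Q′ → Q ≡ Q′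
    single-valued P Q Q′ (partP , _ , regP) PQ PQ′ = reducedArcs-injectiveʳ (proj₁ PQ) (proj₁ PQ′)
      (reduces⇒reducedArcs partP (2-regular regP) PQ) (reduces⇒reducedArcs partP (2-regular regP) PQ′)

    one-to-one : ∀ P P′ Q → InP (suc n) (suc k) (suc (suc m)) P → InP (suc n) (suc k) (suc (suc m)) P′ →
                 Reduces (suc n) P Q → Reduces (suc n) P′ Q → P ≡ P′
    one-to-one P P′ Q (partP , _ , regP) (partP′ , _ , regP′) PQ P′Q = reducedArcs-injectiveˡ partP partP′
      (reduces⇒reducedArcs partP (2-regular regP) PQ) (reduces⇒reducedArcs partP′ (2-regular regP′) P′Q)

    onto : ∀ Q → InP n k (suc m) Q → Σ Partition λ P → InP (suc n) (suc k) (suc (suc m)) P × Reduces (suc n) P Q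
    onto Q (partQ , lenQ , regQ) with expansion partQ
    ... | P , partP , PQ = P , (partP , ≡.trans (reducedArcs-length partP partQ PQ) (cong suc lenQ)
                                      , from (reducedArcs-regular partP partQ PQ) regQ)
                             , reducedArcs⇒reduces partP partQ PQ
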